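{- The following assertions (each universally closed over its free function variable $f$) are pairwise equivalent over $PRA_{fcn}$: 1. $MIN^3$: for ternary $f$, $(\forall m,n)(\exists r)(f(m,n,r)=0)\rightarrow(\exists g)(\forall m,n)(g(m,n)=(\mu r)(f(m,n,r)=0))$, $g$ binary; 2. $MIN^2$: for binary $f$, $(\forall m)(\exists n)(f(m,n)=0)\rightarrow(\exists g)(\forall m)(g(m)=(\mu n)(f(m,n)=0))$, $g$ unary; 3. $MIN^1$: for binary $f$, $(\forall m)(\exists! n)(f(m,n)=0)\rightarrow(\exists g)(\forall m)(f(m,g(m))=0)$, $g$ unary; 4. $PERM$: for unary $f$, $(\forall n)(\exists!m)(f(m)=n)\rightarrow(\exists g)(\forall n)(f(g(n))=n)$, $g$ unary.
   Context: The language $L_{fcn}$ is four-sorted: number variables ranging over $\omega$; function variables of arity 1, 2, 3 ranging over unary, binary, ternary functions on $\omega$; a constant $0$ and unary function symbol $S$ (successor). Terms are number variables, $0$, $S(t)$, and $f(t)$, $f(t,q)$, $f(t,q,r)$ for function variables of the corresponding arity; atomic formulas are equations of terms; formulas use connectives and quantifiers over numbers and functions of each arity. Free variables in axioms are read universally. $PRA_{fcn}$ consists of: (1) Successor axioms: $S(n)\neq 0$; $S(n)=S(m)\rightarrow n=m$; $n\neq 0\rightarrow(\exists m)(S(m)=n)$. (2) Initial function axioms: $(\exists f)(\forall m)(f(m)=n)$ ($f$ unary); ternary projections $(\exists f)(\forall m,n,r)(f(m,n,r)=m)$, and likewise with $=n$, $=r$; $(\exists f)(\forall n)(f(n)=S(n))$.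 (3) Composition axioms: (i) $(\exists f)(\forall m,n,r)(f(m,n,r)=g(m,n))$; (ii) $(\exists f)(\forall m,n,r)(f(m,n,r)=g(m))$; (iii) $(\exists f)(\forall m,n)(f(m,n)=g(m,n,r))$; (iv) $(\exists f)(\forall m)(f(m)=g(m,n,r))$; (v) $(\exists f)(\forall m,n,r)(f(m,n,r)=g(h_1(m,n,r),h_2(m,n,r),h_3(m,n,r)))$. (4) $PRA$: for unary $g$ and ternary $h$, $(\exists f)(\forall m)(f(m,0)=g(m)\wedge(\forall n)(f(m,S(n))=h(m,n,f(m,n))))$, $f$ binary. (6) Rudimentary induction: for unary $f,g$: $f(0)=g(0)\wedge(\forall n)(f(n)=g(n)\rightarrow f(S(n))=g(S(n)))\rightarrow f(n)=g(n)$. Notation: $g(m)=(\mu n)(f(m,n)=0)$ means $f(m,g(m))=0$ and $f(m,r)\neq 0$ for all $r<g(m)$, where $<$ is the natural strict order on $\omega$ (definable in $PRA_{fcn}$, e.g. $r<s$ iff $(\exists t)(r+S(t)=s)$ with $+$ given by primitive recursion); similarly for $(\mu r)(f(m,n,r)=0)$. $(\exists!)$ is the uniqueness quantifier. -}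

module Defs where

open import Level using (0ℓ)
open import Data.Product using (Σ; _×_; _,_)
open import Relation.Binary.PropositionalEquality using (_≡_; _≢_)

-- A (Henkin / general first-order) structure for the four-sorted language L_fcn:
-- a number sort, three function sorts (arities 1,2,3) with application maps,
-- the constant 0 and the successor S.  Equality is interpreted as identity.
record Structure : Set₁ where
  field
    N  : Set
    F1 : Set
    F2 : Set
    F3 : Set
    z  : N
    S  : N → N
    ap1 : F1 → N → N
    ap2 : F2 → N → N → N
    ap3 : F3 → N → N → N → N

module _ (M : Structure) where
  open Structure M

  record PRAfcn : Set where
    field
      succ-ne-zero : ∀ n → S n ≢ z
      succ-inj     : ∀ n m → S n ≡ S m → n ≡ m
      succ-pred    : ∀ n → n ≢ z → Σ N λ m → S m ≡ n
      init-const : ∀ n → Σ F1 λ f → ∀ m → ap1 f m ≡ n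
      init-proj1 : Σ F3 λ f → ∀ m n r → ap3 f m n r ≡ m
      init-proj2 : Σ F3 λ f → ∀ m n r → ap3 f m n r ≡ n
      init-proj3 : Σ F3 λ f → ∀ m n r → ap3 f m n r ≡ r
      init-succ  : Σ F1 λ f → ∀ n → ap1 f n ≡ S n
      comp-i   : ∀ (g : F2) → Σ F3 λ f → ∀ m n r → ap3 f m n r ≡ ap2 g m n
      comp-ii  : ∀ (g : F1) → Σ F3 λ f → ∀ m n r → ap3 f m n r ≡ ap1 g m
      comp-iii : ∀ (g : F3) (r : N) → Σ F2 λ f → ∀ m n → ap2 f m n ≡ ap3 g m n r
      comp-iv  : ∀ (g : F3) (n r : N) → Σ F1 λ f → ∀ m → ap1 f m ≡ ap3 g m n r
      comp-v   : ∀ (g h₁ h₂ h₃ : F3) → Σ F3 λ f → ∀ m n r →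
                   ap3 f m n r ≡ ap3 g (ap3 h₁ m n r) (ap3 h₂ m n r) (ap3 h₃ m n r)
      prim-rec : ∀ (g : F1) (h : F3) → Σ F2 λ f → ∀ m →
                   (ap2 f m z ≡ ap1 g m) × (∀ n → ap2 f m (S n) ≡ ap3 h m n (ap2 f m n))
      rud-ind : ∀ (f g : F1) → ap1 f z ≡ ap1 g z →
                  (∀ n → ap1 f n ≡ ap1 g n → ap1 f (S n) ≡ ap1 g (S n)) →
                  ∀ n → ap1 f n ≡ ap1 g n

  IsAdd : F2 → Set
  IsAdd p = ∀ m → (ap2 p m z ≡ m) × (∀ n → ap2 p m (S n) ≡ S (ap2 p m n))

  _<ᴹ_ : N → N → Set
  r <ᴹ s = Σ F2 λ p → IsAdd p × Σ N λ t → ap2 p r (S t) ≡ s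

  ∃!ᴹ : (N → Set) → Set
  ∃!ᴹ P = Σ N λ n → P n × (∀ n' → P n' → n' ≡ n)

  MIN3 : Set
  MIN3 = ∀ (f : F3) → (∀ m n → Σ N λ r → ap3 f m n r ≡ z) →
         Σ F2 λ g → ∀ m n →
           (ap3 f m n (ap2 g m n) ≡ z) × (∀ r → r <ᴹ ap2 g m n → ap3 f m n r ≢ z)

  MIN2 : Set
  MIN2 = ∀ (f : F2) → (∀ m → Σ N λ n → ap2 f m n ≡ z) →
         Σ F1 λ g → ∀ m →
           (ap2 f m (ap1 g m) ≡ z) × (∀ r → r <ᴹ ap1 g m → ap2 f m r ≢ z)

  MIN1 : Set
  MIN1 = ∀ (f : F2) → (∀ m → ∃!ᴹ λ n → ap2 f m n ≡ z) →
         Σ F1 λ g → ∀ m → ap2 f m (ap1 g m) ≡ z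

  PERM : Set
  PERM = ∀ (f : F1) → (∀ n → ∃!ᴹ λ m → ap1 f m ≡ n) →
         Σ F1 λ g → ∀ n → ap1 f (ap1 g n) ≡ n

-- In a model of PRA_fcn only definable functions exist and induction applies
-- only to equations between them, but guarded implications x n ≡ 0 → a n ≡ b n
-- can be encoded as such equations.  This suffices to develop +, ∸, the order
-- and Cantor pairing inside the model, excluded middle supplying the case splits.
--
-- MIN³ ⇒ MIN² ⇒ MIN¹ are specialisations.  MIN¹ ⇒ PERM: the unique zero of
-- m ↦ |f m − n| is the preimage of n.  MIN¹ ⇒ MIN³: coding (m, n) as p, the
-- function f(p, r) + #{r' < r | f(p, r') = 0} vanishes exactly at the least
-- zero, which exists by a definable bounded search.  PERM ⇒ MIN¹: if n₀ is the
-- unique zero of f m, moving n₀ to 0 and each n < n₀ to n + 1 is a definable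
-- permutation σ m, and the inverse of pair m n ↦ pair m (σ m n) sends pair m 0
-- to pair m n₀.
module Submission where

open import Defs
open import Level using (0ℓ)
open import Axiom.ExcludedMiddle using (ExcludedMiddle)
open import Data.Product using (_×_; Σ; _,_; proj₁; proj₂)
open import Data.Sum using (_⊎_; inj₁; inj₂)
open import Data.Empty using (⊥-elim)
open import Function.Base using (_∘_)
open import Function.Bundles using (_⇔_; mk⇔)
open import Relation.Nullary using (¬_; yes; no)
open import Relation.Binary.PropositionalEquality
  using (_≡_; _≢_; refl; sym; trans; cong; cong₂; subst; module ≡-Reasoning)

module Definability {M : Structure} (PA : PRAfcn M) where
  open Structure M
  open PRAfcn PA

  -- Ternary, the arity for which the composition axiom (3)(v) is available.
  Definable : (N → N → N → N) → Set
  Definable h = Σ F3 λ f → ∀ m n r → ap3 f m n r ≡ h m n r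

  Definable₁ : (N → N) → Set
  Definable₁ a = Definable (λ m _ _ → a m)

  private
    extend : ∀ {h h' : N → N → N → N} →
             Definable h → (∀ m n r → h m n r ≡ h' m n r) → Definable h'
    extend (f , f≡h) h≡h' = f , λ m n r → trans (f≡h m n r) (h≡h' m n r)

    cong₃ : ∀ (g : N → N → N → N) {a a' b b' c c'} →
            a ≡ a' → b ≡ b' → c ≡ c' → g a b c ≡ g a' b' c'
    cong₃ g refl refl refl = refl

  π₁ : Definable (λ m _ _ → m)
  π₁ = init-proj1

  π₂ : Definable (λ _ n _ → n)
  π₂ = init-proj2

  π₃ : Definable (λ _ _ r → r)
  π₃ = init-proj3

  app₃ : ∀ {h₁ h₂ h₃ : N → N → N → N} (g : F3) →
         Definable h₁ → Definable h₂ → Definable h₃ →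
         Definable (λ m n r → ap3 g (h₁ m n r) (h₂ m n r) (h₃ m n r))
  app₃ g (f₁ , e₁) (f₂ , e₂) (f₃ , e₃) with comp-v g f₁ f₂ f₃
  ... | f , f≡ = f , λ m n r → trans (f≡ m n r) (cong₃ (ap3 g) (e₁ m n r) (e₂ m n r) (e₃ m n r))

  app₂ : ∀ {h₁ h₂ : N → N → N → N} (g : F2) → Definable h₁ → Definable h₂ →
         Definable (λ m n r → ap2 g (h₁ m n r) (h₂ m n r))
  app₂ g H₁ H₂ = extend (app₃ (proj₁ (comp-i g)) H₁ H₂ H₁) λ _ _ _ → proj₂ (comp-i g) _ _ _

  app₁ : ∀ {h : N → N → N → N} (g : F1) → Definable h →
         Definable (λ m n r → ap1 g (h m n r))
  app₁ g H = extend (app₃ (proj₁ (comp-ii g)) H H H) λ _ _ _ → proj₂ (comp-ii g) _ _ _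

  constᵈ : ∀ c → Definable (λ _ _ _ → c)
  constᵈ c = extend (app₁ (proj₁ (init-const c)) π₁) λ m _ _ → proj₂ (init-const c) m

  Sᵈ : ∀ {h : N → N → N → N} → Definable h → Definable (λ m n r → S (h m n r))
  Sᵈ H = extend (app₁ (proj₁ init-succ) H) λ _ _ _ → proj₂ init-succ _

  asBinary : ∀ {k : N → N → N} → Definable (λ m n _ → k m n) →
             Σ F2 λ g → ∀ m n → ap2 g m n ≡ k m n
  asBinary (f , e) = proj₁ (comp-iii f z) , λ m n → trans (proj₂ (comp-iii f z) m n) (e m n z)

  asUnary : ∀ {k : N → N} → Definable₁ k → Σ F1 λ g → ∀ m → ap1 g m ≡ k m
  asUnary (f , e) = proj₁ (comp-iv f z z) , λ m → trans (proj₂ (comp-iv f z z) m) (e m z z)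

  record Recursive (g : N → N) (h : N → N → N → N) : Set where
    field
      fn   : F2
      base : ∀ m → ap2 fn m z ≡ g m
      step : ∀ m n → ap2 fn m (S n) ≡ h m n (ap2 fn m n)

  recursion : ∀ {g : N → N} {h : N → N → N → N} → Definable₁ g → Definable h → Recursive g h
  recursion dg (H , H≡) with asUnary dg
  ... | G , G≡ with prim-rec G H
  ... | f , spec = record
    { fn   = f
    ; base = λ m → trans (proj₁ (spec m)) (G≡ m)
    ; step = λ m n → trans (proj₂ (spec m) n) (H≡ m n _)
    }

  record Recursive₁ (c : N) (h : N → N → N) : Set where
    field
      fn   : F1
      base : ap1 fn z ≡ c
      step : ∀ n → ap1 fn (S n) ≡ h n (ap1 fn n)

  recursion₁ : ∀ c {h : N → N → N} → Definable (λ _ n r → h n r) → Recursive₁ c h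
  recursion₁ c {h} dh with recursion (constᵈ c) dh
  ... | record { fn = f₂ ; base = base ; step = step } with asUnary (app₂ f₂ (constᵈ z) π₁)
  ... | f , f≡ = record
    { fn   = f
    ; base = trans (f≡ z) (base z)
    ; step = λ n → trans (f≡ (S n)) (trans (step z n) (cong (h n) (sym (f≡ n))))
    }

  induction : ∀ {a b : N → N} → Definable₁ a → Definable₁ b →
              a z ≡ b z → (∀ n → a n ≡ b n → a (S n) ≡ b (S n)) → ∀ n → a n ≡ b n
  induction {a} {b} da db base step with asUnary da | asUnary db
  ... | fa , fa≡a | fb , fb≡b = λ n → trans (sym (fa≡a n)) (trans (rud-ind fa fb base' step' n) (fb≡b n))
    where
      base' : ap1 fa z ≡ ap1 fb z
      base' = trans (fa≡a z) (trans base (sym (fb≡b z)))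
      step' : ∀ n → ap1 fa n ≡ ap1 fb n → ap1 fa (S n) ≡ ap1 fb (S n)
      step' n h = trans (fa≡a (S n))
        (trans (step n (trans (sym (fa≡a n)) (trans h (fb≡b n)))) (sym (fb≡b (S n))))

  ∃!ᴹ-cong : ∀ {a b : N → N} {c} → (∀ x → a x ≡ b x) →
             ∃!ᴹ M (λ x → b x ≡ c) → ∃!ᴹ M (λ x → a x ≡ c)
  ∃!ᴹ-cong a≡b (x , bx≡c , unique) =
    x , trans (a≡b x) bx≡c , λ x' ax'≡c → unique x' (trans (sym (a≡b x')) ax'≡c)

module Arithmetic (em : ExcludedMiddle 0ℓ) {M : Structure} (PA : PRAfcn M) where
  open Structure M
  open PRAfcn PA
  open Definability PA public
  open ≡-Reasoning

  zero-or-suc : ∀ x → x ≡ z ⊎ Σ N λ y → S y ≡ x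
  zero-or-suc x with em {x ≡ z}
  ... | yes x≡z = inj₁ x≡z
  ... | no x≢z  = inj₂ (succ-pred x x≢z)

  S≢z : ∀ {n} → S n ≢ z
  S≢z = succ-ne-zero _

  one : N
  one = S z

  -- Opaque, so that the type checker never unfolds these functions into their
  -- very large codes in F1 and F2.
  opaque
    private
      module Pred   = Recursive₁ (recursion₁ z π₂)
      module Add    = Recursive (recursion π₁ (Sᵈ π₃))
      module Monus  = Recursive (recursion π₁ (app₁ Pred.fn π₃))
      module IsZero = Recursive₁ (recursion₁ one (constᵈ z))
      module Sg     = Recursive (recursion (constᵈ z) π₁)

    pred : N → N
    pred = ap1 Pred.fn

    pred-zero : pred z ≡ z
    pred-zero = Pred.base

    pred-suc : ∀ n → pred (S n) ≡ n
    pred-suc = Pred.step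

    infixl 6 _+_ _∸_
    infixl 7 _·sg_

    _+_ : N → N → N
    _+_ = ap2 Add.fn

    +-identityʳ : ∀ a → a + z ≡ a
    +-identityʳ = Add.base

    +-suc : ∀ a b → a + S b ≡ S (a + b)
    +-suc = Add.step

    _∸_ : N → N → N
    _∸_ = ap2 Monus.fn

    ∸-identityʳ : ∀ a → a ∸ z ≡ a
    ∸-identityʳ = Monus.base

    ∸-suc : ∀ a b → a ∸ S b ≡ pred (a ∸ b)
    ∸-suc = Monus.step

    is-zero : N → N
    is-zero = ap1 IsZero.fn

    is-zero-zero : is-zero z ≡ one
    is-zero-zero = IsZero.base

    is-zero-suc : ∀ n → is-zero (S n) ≡ z
    is-zero-suc = IsZero.step

    _·sg_ : N → N → N
    _·sg_ = ap2 Sg.fn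

    ·sg-zero : ∀ u → u ·sg z ≡ z
    ·sg-zero = Sg.base

    ·sg-suc : ∀ u n → u ·sg S n ≡ u
    ·sg-suc = Sg.step

    predᵈ : ∀ {h : N → N → N → N} → Definable h → Definable (λ m n r → pred (h m n r))
    predᵈ = app₁ Pred.fn

    _+ᵈ_ : ∀ {h₁ h₂ : N → N → N → N} → Definable h₁ → Definable h₂ →
           Definable (λ m n r → h₁ m n r + h₂ m n r)
    _+ᵈ_ = app₂ Add.fn

    _∸ᵈ_ : ∀ {h₁ h₂ : N → N → N → N} → Definable h₁ → Definable h₂ →
           Definable (λ m n r → h₁ m n r ∸ h₂ m n r)
    _∸ᵈ_ = app₂ Monus.fn

    is-zeroᵈ : ∀ {h : N → N → N → N} → Definable h → Definable (λ m n r → is-zero (h m n r))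
    is-zeroᵈ = app₁ IsZero.fn

    _·sgᵈ_ : ∀ {h₁ h₂ : N → N → N → N} → Definable h₁ → Definable h₂ →
             Definable (λ m n r → h₁ m n r ·sg h₂ m n r)
    _·sgᵈ_ = app₂ Sg.fn

    infixl 6 _+ᵈ_ _∸ᵈ_
    infixl 7 _·sgᵈ_

  is-zero-≢ : ∀ {x} → x ≢ z → is-zero x ≡ z
  is-zero-≢ {x} x≢z with zero-or-suc x
  ... | inj₁ x≡z = ⊥-elim (x≢z x≡z)
  ... | inj₂ (y , Sy≡x) = trans (cong is-zero (sym Sy≡x)) (is-zero-suc y)

  is-zero≡z⇒≢ : ∀ {x} → is-zero x ≡ z → x ≢ z
  is-zero≡z⇒≢ {x} h x≡z = S≢z (trans (sym is-zero-zero) (trans (cong is-zero (sym x≡z)) h))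

  is-zero≢z⇒≡ : ∀ {x} → is-zero x ≢ z → x ≡ z
  is-zero≢z⇒≡ {x} h with zero-or-suc x
  ... | inj₁ x≡z = x≡z
  ... | inj₂ (y , Sy≡x) = ⊥-elim (h (trans (cong is-zero (sym Sy≡x)) (is-zero-suc y)))

  ·sg-one : ∀ u → u ·sg one ≡ u
  ·sg-one u = ·sg-suc u z

  ·sg-≢ : ∀ {x} u → x ≢ z → u ·sg x ≡ u
  ·sg-≢ {x} u x≢z with zero-or-suc x
  ... | inj₁ x≡z = ⊥-elim (x≢z x≡z)
  ... | inj₂ (y , Sy≡x) = trans (cong (u ·sg_) (sym Sy≡x)) (·sg-suc u y)

  -- The implication  x n ≡ z → a n ≡ b n  holds exactly when
  -- a n ·sg is-zero (x n) ≡ b n ·sg is-zero (x n), and the latter is an equation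
  -- between definable functions, to which induction applies.
  guarded-induction : ∀ {x a b : N → N} → Definable₁ x → Definable₁ a → Definable₁ b →
    (x z ≡ z → a z ≡ b z) →
    (∀ n → (x n ≡ z → a n ≡ b n) → x (S n) ≡ z → a (S n) ≡ b (S n)) →
    ∀ n → x n ≡ z → a n ≡ b n
  guarded-induction {x} {a} {b} dx da db base step n =
    decode n (induction (da ·sgᵈ is-zeroᵈ dx) (db ·sgᵈ is-zeroᵈ dx)
                        (encode z base) (λ k h → encode (S k) (step k (decode k h))) n)
    where
      encode : ∀ n → (x n ≡ z → a n ≡ b n) → a n ·sg is-zero (x n) ≡ b n ·sg is-zero (x n)
      encode n imp with em {x n ≡ z}
      ... | yes x≡z = cong (_·sg is-zero (x n)) (imp x≡z)
      ... | no x≢z = begin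
        a n ·sg is-zero (x n)  ≡⟨ cong (a n ·sg_) (is-zero-≢ x≢z) ⟩
        a n ·sg z              ≡⟨ ·sg-zero (a n) ⟩
        z                      ≡⟨ sym (·sg-zero (b n)) ⟩
        b n ·sg z              ≡⟨ cong (b n ·sg_) (sym (is-zero-≢ x≢z)) ⟩
        b n ·sg is-zero (x n)  ∎
      decode : ∀ n → a n ·sg is-zero (x n) ≡ b n ·sg is-zero (x n) → x n ≡ z → a n ≡ b n
      decode n eq x≡z = begin
        a n                    ≡⟨ sym (·sg-one (a n)) ⟩
        a n ·sg one            ≡⟨ cong (a n ·sg_) (sym is-one) ⟩
        a n ·sg is-zero (x n)  ≡⟨ eq ⟩
        b n ·sg is-zero (x n)  ≡⟨ cong (b n ·sg_) is-one ⟩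
        b n ·sg one            ≡⟨ ·sg-one (b n) ⟩
        b n                    ∎
        where is-one = trans (cong is-zero x≡z) is-zero-zero

  +-identityˡ : ∀ n → z + n ≡ n
  +-identityˡ = induction (constᵈ z +ᵈ π₁) π₁ (+-identityʳ z) λ n h → trans (+-suc z n) (cong S h)

  suc-+ : ∀ a n → S a + n ≡ S (a + n)
  suc-+ a = induction (constᵈ (S a) +ᵈ π₁) (Sᵈ (constᵈ a +ᵈ π₁))
    (trans (+-identityʳ (S a)) (cong S (sym (+-identityʳ a))))
    λ n h → trans (+-suc (S a) n) (cong S (trans h (sym (+-suc a n))))

  +-comm : ∀ a b → a + b ≡ b + a
  +-comm a = induction (constᵈ a +ᵈ π₁) (π₁ +ᵈ constᵈ a)
    (trans (+-identityʳ a) (sym (+-identityˡ a)))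
    λ b h → trans (+-suc a b) (trans (cong S h) (sym (suc-+ b a)))

  1+n≡suc : ∀ n → one + n ≡ S n
  1+n≡suc n = trans (suc-+ z n) (cong S (+-identityˡ n))

  m+1≡suc : ∀ n → n + one ≡ S n
  m+1≡suc n = trans (+-suc n z) (cong S (+-identityʳ n))

  +-zero-zero : ∀ {x y} → x ≡ z → y ≡ z → x + y ≡ z
  +-zero-zero x≡z y≡z = trans (cong₂ _+_ x≡z y≡z) (+-identityʳ z)

  +-eq-zero : ∀ {x y} → x + y ≡ z → x ≡ z × y ≡ z
  +-eq-zero {x} {y} x+y≡z with zero-or-suc y
  ... | inj₁ y≡z = trans (sym (+-identityʳ x)) (trans (cong (x +_) (sym y≡z)) x+y≡z) , y≡z
  ... | inj₂ (y' , Sy'≡y) =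
    ⊥-elim (S≢z (trans (sym (+-suc x y')) (trans (cong (x +_) Sy'≡y) x+y≡z)))

  m≢0⇒m+n≢0 : ∀ {x} y → x ≢ z → x + y ≢ z
  m≢0⇒m+n≢0 y x≢z x+y≡z = x≢z (proj₁ (+-eq-zero x+y≡z))

  0∸n≡0 : ∀ n → z ∸ n ≡ z
  0∸n≡0 = induction (constᵈ z ∸ᵈ π₁) (constᵈ z) (∸-identityʳ z)
    λ n h → trans (∸-suc z n) (trans (cong pred h) pred-zero)

  [1+m]∸[1+n]≡m∸n : ∀ a b → S a ∸ S b ≡ a ∸ b
  [1+m]∸[1+n]≡m∸n a = induction (constᵈ (S a) ∸ᵈ Sᵈ π₁) (constᵈ a ∸ᵈ π₁)
    (trans (∸-suc (S a) z) (trans (cong pred (∸-identityʳ (S a)))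
      (trans (pred-suc a) (sym (∸-identityʳ a)))))
    λ b h → trans (∸-suc (S a) (S b)) (trans (cong pred h) (sym (∸-suc a b)))

  m+n∸n≡m : ∀ a b → a + b ∸ b ≡ a
  m+n∸n≡m a = induction (constᵈ a +ᵈ π₁ ∸ᵈ π₁) (constᵈ a)
    (trans (∸-identityʳ (a + z)) (+-identityʳ a))
    λ b h → trans (cong (_∸ S b) (+-suc a b)) (trans ([1+m]∸[1+n]≡m∸n (a + b) b) h)

  m+n∸m≡n : ∀ a b → a + b ∸ a ≡ b
  m+n∸m≡n a b = trans (cong (_∸ a) (+-comm a b)) (m+n∸n≡m b a)

  n∸n≡0 : ∀ a → a ∸ a ≡ z
  n∸n≡0 a = trans (cong (_∸ a) (sym (+-identityˡ a))) (m+n∸n≡m z a)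

  1+n∸n≡1 : ∀ n → S n ∸ n ≡ one
  1+n∸n≡1 n = trans (cong (_∸ n) (sym (1+n≡suc n))) (m+n∸n≡m one n)

  m∸[m+n]≡0 : ∀ a c → a ∸ (a + c) ≡ z
  m∸[m+n]≡0 a = induction (constᵈ a ∸ᵈ (constᵈ a +ᵈ π₁)) (constᵈ z)
    (trans (cong (a ∸_) (+-identityʳ a)) (n∸n≡0 a))
    λ c h → trans (cong (a ∸_) (+-suc a c)) (trans (∸-suc a (a + c)) (trans (cong pred h) pred-zero))

  [m+n]∸[m+o]≡n∸o : ∀ a b c → a + b ∸ (a + c) ≡ b ∸ c
  [m+n]∸[m+o]≡n∸o a b c = trans (cong₂ _∸_ (+-comm a b) (+-comm a c)) (shift a)
    where
      shift : ∀ a → b + a ∸ (c + a) ≡ b ∸ c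
      shift = induction (constᵈ b +ᵈ π₁ ∸ᵈ (constᵈ c +ᵈ π₁)) (constᵈ (b ∸ c))
        (cong₂ _∸_ (+-identityʳ b) (+-identityʳ c))
        λ a h → trans (cong₂ _∸_ (+-suc b a) (+-suc c a)) (trans ([1+m]∸[1+n]≡m∸n _ _) h)

  pred[1+m∸n]≡m∸n : ∀ a b → pred (S a ∸ b) ≡ a ∸ b
  pred[1+m∸n]≡m∸n a = induction (predᵈ (constᵈ (S a) ∸ᵈ π₁)) (constᵈ a ∸ᵈ π₁)
    (trans (cong pred (∸-identityʳ (S a))) (trans (pred-suc a) (sym (∸-identityʳ a))))
    λ b h → trans (cong pred (∸-suc (S a) b)) (trans (cong pred h) (sym (∸-suc a b)))

  m∸n≡1+o⇒m∸[1+n]≡o : ∀ {a b o} → S o ≡ a ∸ b → a ∸ S b ≡ o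
  m∸n≡1+o⇒m∸[1+n]≡o {a} {b} {o} e = trans (∸-suc a b) (trans (cong pred (sym e)) (pred-suc o))

  infix 4 _≤_ _<_

  _≤_ : N → N → Set
  a ≤ b = a ∸ b ≡ z

  _<_ : N → N → Set
  a < b = Σ N λ t → b ≡ a + S t

  ≤-refl : ∀ a → a ≤ a
  ≤-refl = n∸n≡0

  ≤-step : ∀ {a b} → a ≤ b → a ≤ S b
  ≤-step {a} {b} a≤b = trans (∸-suc a b) (trans (cong pred a≤b) pred-zero)

  1+m≤n⇒m≤n : ∀ {a b} → S a ≤ b → a ≤ b
  1+m≤n⇒m≤n {a} {b} h = trans (sym (pred[1+m∸n]≡m∸n a b)) (trans (cong pred h) pred-zero)

  1+m≤n⇒m≢n : ∀ {a b} → S a ≤ b → a ≢ b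
  1+m≤n⇒m≢n {a} h refl = S≢z (trans (sym (1+n∸n≡1 a)) h)

  <⇒≱ : ∀ {a b} → a < b → ¬ (b ≤ a)
  <⇒≱ {a} (t , refl) b≤a = S≢z (trans (sym (m+n∸m≡n a (S t))) b≤a)

  <⇒≢ : ∀ {a b} → a < b → a ≢ b
  <⇒≢ {a} a<b refl = <⇒≱ a<b (≤-refl a)

  m∸n+n≡m : ∀ {a b} → b ≤ a → a ∸ b + b ≡ a
  m∸n+n≡m {a} {b} = guarded-induction (π₁ ∸ᵈ constᵈ a) (constᵈ a ∸ᵈ π₁ +ᵈ π₁) (constᵈ a)
    (λ _ → trans (+-identityʳ (a ∸ z)) (∸-identityʳ a)) step b
    where
      step : ∀ b → (b ≤ a → a ∸ b + b ≡ a) → S b ≤ a → a ∸ S b + S b ≡ a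
      step b ih Sb≤a with zero-or-suc (a ∸ b)
      ... | inj₁ a∸b≡z = ⊥-elim (1+m≤n⇒m≢n Sb≤a
              (trans (sym (+-identityˡ b)) (trans (cong (_+ b) (sym a∸b≡z)) (ih (1+m≤n⇒m≤n Sb≤a)))))
      ... | inj₂ (y , Sy≡a∸b) = begin
        a ∸ S b + S b  ≡⟨ cong (_+ S b) (m∸n≡1+o⇒m∸[1+n]≡o Sy≡a∸b) ⟩
        y + S b        ≡⟨ +-suc y b ⟩
        S (y + b)      ≡⟨ sym (suc-+ y b) ⟩
        S y + b        ≡⟨ cong (_+ b) Sy≡a∸b ⟩
        a ∸ b + b      ≡⟨ ih (1+m≤n⇒m≤n Sb≤a) ⟩
        a              ∎

  m+[n∸m]≡n : ∀ {a b} → a ≤ b → a + (b ∸ a) ≡ b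
  m+[n∸m]≡n {a} {b} a≤b = trans (+-comm a (b ∸ a)) (m∸n+n≡m a≤b)

  ≤-antisym : ∀ {a b} → a ≤ b → b ≤ a → a ≡ b
  ≤-antisym {a} {b} a≤b b≤a = trans (sym (m∸n+n≡m b≤a)) (trans (cong (_+ b) a≤b) (+-identityˡ b))

  ≤∧≢⇒1+m≤n : ∀ {a b} → a ≤ b → a ≢ b → S a ≤ b
  ≤∧≢⇒1+m≤n {a} {b} a≤b a≢b with zero-or-suc (b ∸ a)
  ... | inj₁ b≤a = ⊥-elim (a≢b (≤-antisym a≤b b≤a))
  ... | inj₂ (c , Sc≡b∸a) = trans (cong (S a ∸_) b≡) (m∸[m+n]≡0 (S a) c)
    where
      b≡ : b ≡ S a + c
      b≡ = begin
        b            ≡⟨ sym (m+[n∸m]≡n a≤b) ⟩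
        a + (b ∸ a)  ≡⟨ cong (a +_) (sym Sc≡b∸a) ⟩
        a + S c      ≡⟨ +-suc a c ⟩
        S (a + c)    ≡⟨ sym (suc-+ a c) ⟩
        S a + c      ∎

  ≤-total : ∀ a b → a ≤ b ⊎ b ≤ a
  ≤-total a b with em {a ≤ b}
  ... | yes a≤b = inj₁ a≤b
  ... | no a≰b  = inj₂ (≰⇒≥ b (is-zero-≢ a≰b))
    where
      step : ∀ b → (is-zero (a ∸ b) ≡ z → b ≤ a) → is-zero (a ∸ S b) ≡ z → S b ≤ a
      step b ih h with zero-or-suc (a ∸ b)
      ... | inj₁ a∸b≡z = ⊥-elim (is-zero≡z⇒≢ h (≤-step a∸b≡z))
      ... | inj₂ (y , Sy≡a∸b) = trans (cong (S b ∸_) a≡) (m∸[m+n]≡0 (S b) y)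
        where
          a≡ : a ≡ S b + y
          a≡ = begin
            a          ≡⟨ sym (m∸n+n≡m (ih (is-zero-≢ λ a∸b≡z → S≢z (trans Sy≡a∸b a∸b≡z)))) ⟩
            a ∸ b + b  ≡⟨ cong (_+ b) (sym Sy≡a∸b) ⟩
            S y + b    ≡⟨ suc-+ y b ⟩
            S (y + b)  ≡⟨ cong S (+-comm y b) ⟩
            S (b + y)  ≡⟨ sym (suc-+ b y) ⟩
            S b + y    ∎
      ≰⇒≥ : ∀ b → is-zero (a ∸ b) ≡ z → b ≤ a
      ≰⇒≥ = guarded-induction (is-zeroᵈ (constᵈ a ∸ᵈ π₁)) (π₁ ∸ᵈ constᵈ a) (constᵈ z)
        (λ _ → 0∸n≡0 a) step

  ≤⊎> : ∀ a b → a ≤ b ⊎ b < a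
  ≤⊎> a b with ≤-total a b
  ... | inj₁ a≤b = inj₁ a≤b
  ... | inj₂ b≤a with zero-or-suc (a ∸ b)
  ...   | inj₁ a≤b = inj₁ a≤b
  ...   | inj₂ (t , St≡a∸b) = inj₂ (t , (begin
    a          ≡⟨ sym (m∸n+n≡m b≤a) ⟩
    a ∸ b + b  ≡⟨ cong (_+ b) (sym St≡a∸b) ⟩
    S t + b    ≡⟨ +-comm (S t) b ⟩
    b + S t    ∎))

  +-cancelˡ : ∀ x {b c} → x + b ≡ x + c → b ≡ c
  +-cancelˡ x {b} {c} e = trans (sym (m+n∸m≡n x b)) (trans (cong (_∸ x) e) (m+n∸m≡n x c))

  IsAdd⇒≡+ : ∀ {p} → IsAdd M p → ∀ r n → ap2 p r n ≡ r + n
  IsAdd⇒≡+ {p} p-add r = induction (app₂ p (constᵈ r) π₁) (constᵈ r +ᵈ π₁)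
    (trans (proj₁ (p-add r)) (sym (+-identityʳ r)))
    λ n h → trans (proj₂ (p-add r) n) (trans (cong S h) (sym (+-suc r n)))

  <ᴹ⇒< : ∀ {r s} → _<ᴹ_ M r s → r < s
  <ᴹ⇒< {r} (p , p-add , t , e) = t , trans (sym e) (IsAdd⇒≡+ p-add r (S t))

  dist : N → N → N
  dist a b = a ∸ b + (b ∸ a)

  distᵈ : ∀ {h₁ h₂ : N → N → N → N} → Definable h₁ → Definable h₂ →
          Definable (λ m n r → dist (h₁ m n r) (h₂ m n r))
  distᵈ H₁ H₂ = H₁ ∸ᵈ H₂ +ᵈ (H₂ ∸ᵈ H₁)

  dist-self : ∀ a → dist a a ≡ z
  dist-self a = +-zero-zero (n∸n≡0 a) (n∸n≡0 a)

  dist≡0⇒≡ : ∀ {a b} → dist a b ≡ z → a ≡ b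
  dist≡0⇒≡ d≡z = ≤-antisym (proj₁ (+-eq-zero d≡z)) (proj₂ (+-eq-zero d≡z))

  ∃!ᴹ-dist : ∀ {a : N → N} {n} → ∃!ᴹ M (λ m → a m ≡ n) → ∃!ᴹ M (λ m → dist (a m) n ≡ z)
  ∃!ᴹ-dist {n = n} (m , am≡n , unique) =
    m , trans (cong (λ v → dist v n) am≡n) (dist-self n) , λ m' d≡z → unique m' (dist≡0⇒≡ d≡z)

  δ : N → N → N
  δ a b = is-zero (dist a b)

  δᵈ : ∀ {h₁ h₂ : N → N → N → N} → Definable h₁ → Definable h₂ →
       Definable (λ m n r → δ (h₁ m n r) (h₂ m n r))
  δᵈ H₁ H₂ = is-zeroᵈ (distᵈ H₁ H₂)

  δ-refl : ∀ a → δ a a ≡ one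
  δ-refl a = trans (cong is-zero (dist-self a)) is-zero-zero

  δ-≢ : ∀ {a b} → a ≢ b → δ a b ≡ z
  δ-≢ a≢b = is-zero-≢ λ d≡z → a≢b (dist≡0⇒≡ d≡z)

-- Cantor pairing: T d = d(d+1)/2 is the d-th triangular number and diag x the
-- diagonal through x, i.e. the d with T d ≤ x ≤ T d + d.
module Pairing (em : ExcludedMiddle 0ℓ) {M : Structure} (PA : PRAfcn M) where
  open Structure M
  open PRAfcn PA
  open Arithmetic em PA public
  open ≡-Reasoning

  opaque
    private
      module Tri  = Recursive₁ (recursion₁ z (Sᵈ (π₃ +ᵈ π₂)))
      module Diag = Recursive₁ (recursion₁ z (π₃ +ᵈ δᵈ (app₁ Tri.fn (Sᵈ π₃)) (Sᵈ π₂)))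

    T : N → N
    T = ap1 Tri.fn

    T-zero : T z ≡ z
    T-zero = Tri.base

    T-suc : ∀ d → T (S d) ≡ S (T d + d)
    T-suc = Tri.step

    diag : N → N
    diag = ap1 Diag.fn

    diag-zero : diag z ≡ z
    diag-zero = Diag.base

    diag-suc : ∀ x → diag (S x) ≡ diag x + δ (T (S (diag x))) (S x)
    diag-suc = Diag.step

    Tᵈ : ∀ {h : N → N → N → N} → Definable h → Definable (λ m n r → T (h m n r))
    Tᵈ = app₁ Tri.fn

    diagᵈ : ∀ {h : N → N → N → N} → Definable h → Definable (λ m n r → diag (h m n r))
    diagᵈ = app₁ Diag.fn

  private
    diag-suc-from : ∀ {x c} → diag x ≡ c → diag (S x) ≡ c + δ (T (S c)) (S x)
    diag-suc-from {x} refl = diag-suc x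

    diag-along : ∀ c → diag (T c) ≡ c → ∀ b → b ≤ c → diag (T c + b) ≡ c
    diag-along c diag-Tc = guarded-induction (π₁ ∸ᵈ constᵈ c) (diagᵈ (constᵈ (T c) +ᵈ π₁)) (constᵈ c)
      (λ _ → trans (cong diag (+-identityʳ (T c))) diag-Tc) step
      where
        step : ∀ b → (b ≤ c → diag (T c + b) ≡ c) → S b ≤ c → diag (T c + S b) ≡ c
        step b ih Sb≤c = begin
          diag (T c + S b)               ≡⟨ cong diag (+-suc (T c) b) ⟩
          diag (S (T c + b))             ≡⟨ diag-suc-from (ih (1+m≤n⇒m≤n Sb≤c)) ⟩
          c + δ (T (S c)) (S (T c + b))  ≡⟨ cong (c +_) (δ-≢ next≢) ⟩
          c + z                          ≡⟨ +-identityʳ c ⟩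
          c                              ∎
          where
            next≢ : T (S c) ≢ S (T c + b)
            next≢ e = 1+m≤n⇒m≢n Sb≤c (sym (+-cancelˡ (T c) (succ-inj _ _ (trans (sym (T-suc c)) e))))

  diag-T : ∀ c → diag (T c) ≡ c
  diag-T = induction (diagᵈ (Tᵈ π₁)) π₁ (trans (cong diag T-zero) diag-zero) step
    where
      step : ∀ c → diag (T c) ≡ c → diag (T (S c)) ≡ S c
      step c diag-Tc = begin
        diag (T (S c))                 ≡⟨ cong diag (T-suc c) ⟩
        diag (S (T c + c))             ≡⟨ diag-suc-from (diag-along c diag-Tc c (≤-refl c)) ⟩
        c + δ (T (S c)) (S (T c + c))  ≡⟨ cong (λ v → c + δ (T (S c)) v) (sym (T-suc c)) ⟩
        c + δ (T (S c)) (T (S c))      ≡⟨ cong (c +_) (δ-refl (T (S c))) ⟩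
        c + one                        ≡⟨ m+1≡suc c ⟩
        S c                            ∎

  diag-T+ : ∀ {b c} → b ≤ c → diag (T c + b) ≡ c
  diag-T+ {b} {c} = diag-along c (diag-T c) b

  diag-bounds : ∀ x → T (diag x) ≤ x × x ≤ T (diag x) + diag x
  diag-bounds x = +-eq-zero (induction
    (Tᵈ (diagᵈ π₁) ∸ᵈ π₁ +ᵈ (π₁ ∸ᵈ (Tᵈ (diagᵈ π₁) +ᵈ diagᵈ π₁))) (constᵈ z)
    (both base) (λ x h → both (step x (+-eq-zero h))) x)
    where
      both : ∀ {a b} → a ≡ z × b ≡ z → a + b ≡ z
      both (a≡z , b≡z) = +-zero-zero a≡z b≡z
      base : T (diag z) ≤ z × z ≤ T (diag z) + diag z
      base = subst (_≤ z) (sym (trans (cong T diag-zero) T-zero)) (≤-refl z) , 0∸n≡0 _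
      step : ∀ x → T (diag x) ≤ x × x ≤ T (diag x) + diag x →
             T (diag (S x)) ≤ S x × S x ≤ T (diag (S x)) + diag (S x)
      step x (lower , upper) with em {T (S (diag x)) ≡ S x}
      ... | yes e = subst (λ d → T d ≤ S x × S x ≤ T d + d) (sym diag-Sx)
                      (trans (cong (_∸ S x) e) (≤-refl (S x)) ,
                       trans (cong (λ v → S x ∸ (v + S (diag x))) e) (m∸[m+n]≡0 (S x) (S (diag x))))
        where
          diag-Sx : diag (S x) ≡ S (diag x)
          diag-Sx = trans (diag-suc x) (trans (cong (diag x +_) (trans (cong (δ _) (sym e)) (δ-refl _)))
                                              (m+1≡suc (diag x)))
      ... | no ne = subst (λ d → T d ≤ S x × S x ≤ T d + d) (sym diag-Sx)
                      (≤-step lower , ≤∧≢⇒1+m≤n upper λ e → ne (trans (T-suc (diag x)) (cong S (sym e))))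
        where
          diag-Sx : diag (S x) ≡ diag x
          diag-Sx = trans (diag-suc x) (trans (cong (diag x +_) (δ-≢ ne)) (+-identityʳ (diag x)))

  pair : N → N → N
  pair a b = T (a + b) + b

  snd : N → N
  snd x = x ∸ T (diag x)

  fst : N → N
  fst x = diag x ∸ snd x

  pairᵈ : ∀ {h₁ h₂ : N → N → N → N} → Definable h₁ → Definable h₂ →
          Definable (λ m n r → pair (h₁ m n r) (h₂ m n r))
  pairᵈ H₁ H₂ = Tᵈ (H₁ +ᵈ H₂) +ᵈ H₂

  sndᵈ : ∀ {h : N → N → N → N} → Definable h → Definable (λ m n r → snd (h m n r))
  sndᵈ H = H ∸ᵈ Tᵈ (diagᵈ H)

  fstᵈ : ∀ {h : N → N → N → N} → Definable h → Definable (λ m n r → fst (h m n r))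
  fstᵈ H = diagᵈ H ∸ᵈ sndᵈ H

  private
    diag-pair : ∀ a b → diag (pair a b) ≡ a + b
    diag-pair a b = diag-T+ (trans (cong (b ∸_) (+-comm a b)) (m∸[m+n]≡0 b a))

  snd-pair : ∀ a b → snd (pair a b) ≡ b
  snd-pair a b = trans (cong (λ d → pair a b ∸ T d) (diag-pair a b)) (m+n∸m≡n (T (a + b)) b)

  fst-pair : ∀ a b → fst (pair a b) ≡ a
  fst-pair a b = trans (cong₂ _∸_ (diag-pair a b) (snd-pair a b)) (m+n∸n≡m a b)

  pair-fst-snd : ∀ x → pair (fst x) (snd x) ≡ x
  pair-fst-snd x = trans (cong (λ v → T v + snd x) fst+snd) (m+[n∸m]≡n lower)
    where
      d : N
      d = diag x
      lower : T d ≤ x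
      lower = proj₁ (diag-bounds x)
      snd≤d : snd x ≤ d
      snd≤d = begin
        snd x ∸ d                     ≡⟨ sym ([m+n]∸[m+o]≡n∸o (T d) (snd x) d) ⟩
        T d + snd x ∸ (T d + d)       ≡⟨ cong (_∸ (T d + d)) (m+[n∸m]≡n lower) ⟩
        x ∸ (T d + d)                 ≡⟨ proj₂ (diag-bounds x) ⟩
        z                             ∎
      fst+snd : fst x + snd x ≡ d
      fst+snd = m∸n+n≡m snd≤d

  pair-injective : ∀ {a b a' b'} → pair a b ≡ pair a' b' → a ≡ a' × b ≡ b'
  pair-injective {a} {b} {a'} {b'} e =
    trans (sym (fst-pair a b)) (trans (cong fst e) (fst-pair a' b')) ,
    trans (sym (snd-pair a b)) (trans (cong snd e) (snd-pair a' b'))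

module ZeroCount (em : ExcludedMiddle 0ℓ) {M : Structure} (PA : PRAfcn M)
                 (φ : Structure.N M → Structure.N M → Structure.N M)
                 (φᵈ : Definability.Definable PA λ p r _ → φ p r) where
  open Structure M
  open PRAfcn PA
  open Arithmetic em PA

  opaque
    private
      module Zeros = Recursive (recursion (constᵈ z) (π₃ +ᵈ is-zeroᵈ φᵈ))

    zeros : N → N → N
    zeros = ap2 Zeros.fn

    zeros-zero : ∀ p → zeros p z ≡ z
    zeros-zero = Zeros.base

    zeros-suc : ∀ p r → zeros p (S r) ≡ zeros p r + is-zero (φ p r)
    zeros-suc = Zeros.step

    zerosᵈ : ∀ {h₁ h₂ : N → N → N → N} → Definable h₁ → Definable h₂ →
             Definable (λ a b c → zeros (h₁ a b c) (h₂ a b c))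
    zerosᵈ = app₂ Zeros.fn

  zeros-suc-at-zero : ∀ {p r} → φ p r ≡ z → zeros p (S r) ≡ S (zeros p r)
  zeros-suc-at-zero {p} {r} φ≡z =
    trans (zeros-suc p r) (trans (cong (λ v → zeros p r + is-zero v) φ≡z)
                                 (trans (cong (zeros p r +_) is-zero-zero) (m+1≡suc (zeros p r))))

  zeros-after : ∀ {p r r'} → φ p r ≡ z → r < r' → zeros p r' ≢ z
  zeros-after {p} {r} φ≡z (t , refl) = is-zero≡z⇒≢ (positive t)
    where
      positive : ∀ t → is-zero (zeros p (r + S t)) ≡ z
      positive = induction (is-zeroᵈ (zerosᵈ (constᵈ p) (constᵈ r +ᵈ Sᵈ π₁))) (constᵈ z)
        (is-zero-≢ λ e → S≢z (trans (sym (zeros-suc-at-zero φ≡z))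
                                    (trans (cong (zeros p) (sym (m+1≡suc r))) e)))
        λ t h → is-zero-≢ λ e → m≢0⇒m+n≢0 _ (is-zero≡z⇒≢ h)
                  (trans (sym (zeros-suc p (r + S t))) (trans (cong (zeros p) (sym (+-suc r (S t)))) e))

module Minimisation (em : ExcludedMiddle 0ℓ) {M : Structure} (PA : PRAfcn M) (f : Structure.F3 M) where
  open Structure M
  open PRAfcn PA
  open Pairing em PA
  open ≡-Reasoning

  φ : N → N → N
  φ p r = ap3 f (fst p) (snd p) r

  φᵈ : ∀ {h₁ h₂ : N → N → N → N} → Definable h₁ → Definable h₂ →
       Definable (λ a b c → φ (h₁ a b c) (h₂ a b c))
  φᵈ H₁ H₂ = app₃ f (fstᵈ H₁) (sndᵈ H₁) H₂

  open ZeroCount em PA φ (φᵈ π₁ π₂) public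

  opaque
    private
      module Search = Recursive (recursion (constᵈ z) (π₃ +ᵈ is-zeroᵈ (zerosᵈ π₁ (Sᵈ π₂))))

    -- the minimum of j and the least zero of φ p
    search : N → N → N
    search = ap2 Search.fn

    search-zero : ∀ p → search p z ≡ z
    search-zero = Search.base

    search-suc : ∀ p j → search p (S j) ≡ search p j + is-zero (zeros p (S j))
    search-suc = Search.step

    searchᵈ : ∀ {h₁ h₂ : N → N → N → N} → Definable h₁ → Definable h₂ →
              Definable (λ a b c → search (h₁ a b c) (h₂ a b c))
    searchᵈ = app₂ Search.fn

  LeastZero : N → N → Set
  LeastZero p r = φ p r ≡ z × zeros p r ≡ z

  least-zero-unique : ∀ {p r r'} → LeastZero p r → LeastZero p r' → r ≡ r'
  least-zero-unique {p} {r} {r'} (φr , zr) (φr' , zr') with ≤⊎> r r'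
  ... | inj₂ r'<r = ⊥-elim (zeros-after φr' r'<r zr)
  ... | inj₁ r≤r' with ≤⊎> r' r
  ...   | inj₂ r<r' = ⊥-elim (zeros-after φr r<r' zr')
  ...   | inj₁ r'≤r = ≤-antisym r≤r' r'≤r

  search-below : ∀ p j → zeros p j ≡ z → search p j ≡ j
  search-below p = guarded-induction (zerosᵈ (constᵈ p) π₁) (searchᵈ (constᵈ p) π₁) π₁
    (λ _ → search-zero p) step
    where
      step : ∀ j → (zeros p j ≡ z → search p j ≡ j) → zeros p (S j) ≡ z → search p (S j) ≡ S j
      step j ih zeros≡z = begin
        search p (S j)                         ≡⟨ search-suc p j ⟩
        search p j + is-zero (zeros p (S j))   ≡⟨ cong₂ _+_ (ih zeros-j) (cong is-zero zeros≡z) ⟩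
        j + is-zero z                          ≡⟨ cong (j +_) is-zero-zero ⟩
        j + one                                ≡⟨ m+1≡suc j ⟩
        S j                                    ∎
        where
          zeros-j : zeros p j ≡ z
          zeros-j = proj₁ (+-eq-zero (trans (sym (zeros-suc p j)) zeros≡z))

  search-least : ∀ p j → zeros p j ≢ z → LeastZero p (search p j)
  search-least p j zeros≢z = +-eq-zero (invariant j (is-zero-≢ zeros≢z))
    where
      step : ∀ j → (is-zero (zeros p j) ≡ z → φ p (search p j) + zeros p (search p j) ≡ z) →
             is-zero (zeros p (S j)) ≡ z → φ p (search p (S j)) + zeros p (search p (S j)) ≡ z
      step j ih h with em {zeros p j ≡ z}
      ... | no zeros≢z = trans (cong (λ v → φ p v + zeros p v) search-Sj) (ih (is-zero-≢ zeros≢z))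
        where
          search-Sj : search p (S j) ≡ search p j
          search-Sj = trans (search-suc p j) (trans (cong (search p j +_) h) (+-identityʳ _))
      ... | yes zeros≡z = trans (cong (λ v → φ p v + zeros p v) search-Sj) (+-zero-zero φ≡z zeros≡z)
        where
          search-Sj : search p (S j) ≡ j
          search-Sj = trans (search-suc p j) (trans (cong₂ _+_ (search-below p j zeros≡z) h) (+-identityʳ j))
          φ≡z : φ p j ≡ z
          φ≡z = is-zero≢z⇒≡ λ e → is-zero≡z⇒≢ h
                  (trans (zeros-suc p j) (+-zero-zero zeros≡z e))
      invariant : ∀ j → is-zero (zeros p j) ≡ z → φ p (search p j) + zeros p (search p j) ≡ z
      invariant = guarded-induction (is-zeroᵈ (zerosᵈ (constᵈ p) π₁))
        (φᵈ (constᵈ p) (searchᵈ (constᵈ p) π₁) +ᵈ zerosᵈ (constᵈ p) (searchᵈ (constᵈ p) π₁))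
        (constᵈ z)
        (λ h → ⊥-elim (is-zero≡z⇒≢ h (zeros-zero p))) step

  least-zero-∃! : ∀ {p r} → φ p r ≡ z → ∃!ᴹ M λ r' → φ p r' + zeros p r' ≡ z
  least-zero-∃! {p} {r} φ≡z =
    search p (S r) , +-zero-zero (proj₁ least) (proj₂ least) ,
    λ r' e → least-zero-unique (+-eq-zero e) least
    where
      least : LeastZero p (search p (S r))
      least = search-least p (S r) λ e → S≢z (trans (sym (zeros-suc-at-zero φ≡z)) e)

  φ-pair : ∀ m n r → φ (pair m n) r ≡ ap3 f m n r
  φ-pair m n r = cong₂ (λ a b → ap3 f a b r) (fst-pair m n) (snd-pair m n)

module Permutation (em : ExcludedMiddle 0ℓ) {M : Structure} (PA : PRAfcn M) (f : Structure.F2 M) where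
  open Structure M
  open PRAfcn PA
  open Pairing em PA
  open ZeroCount em PA (ap2 f) (app₂ f π₁ π₂)
  open ≡-Reasoning

  -- If n₀ is the only zero of f m, then σ m sends n₀ to z, each n < n₀ to S n
  -- and fixes each n > n₀; so σ m is a permutation.
  σ : N → N → N
  σ m n = (n + is-zero (zeros m n)) ·sg ap2 f m n

  σᵈ : ∀ {h₁ h₂ : N → N → N → N} → Definable h₁ → Definable h₂ →
       Definable (λ a b c → σ (h₁ a b c) (h₂ a b c))
  σᵈ H₁ H₂ = (H₂ +ᵈ is-zeroᵈ (zerosᵈ H₁ H₂)) ·sgᵈ app₂ f H₁ H₂

  module Row (m : N) (unique-zero : ∃!ᴹ M λ n → ap2 f m n ≡ z) where
    n₀ : N
    n₀ = proj₁ unique-zero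

    f-n₀ : ap2 f m n₀ ≡ z
    f-n₀ = proj₁ (proj₂ unique-zero)

    f-off : ∀ {n} → n ≢ n₀ → ap2 f m n ≢ z
    f-off n≢n₀ f≡z = n≢n₀ (proj₂ (proj₂ unique-zero) _ f≡z)

    zeros-upto : ∀ n → n ≤ n₀ → zeros m n ≡ z
    zeros-upto = guarded-induction (π₁ ∸ᵈ constᵈ n₀) (zerosᵈ (constᵈ m) π₁) (constᵈ z)
      (λ _ → zeros-zero m)
      λ n ih Sn≤n₀ → trans (zeros-suc m n)
        (+-zero-zero (ih (1+m≤n⇒m≤n Sn≤n₀)) (is-zero-≢ (f-off (1+m≤n⇒m≢n Sn≤n₀))))

    zeros-past-n₀ : ∀ {n} → n₀ < n → zeros m n ≡ one
    zeros-past-n₀ (t , refl) = induction (zerosᵈ (constᵈ m) (constᵈ n₀ +ᵈ Sᵈ π₁)) (constᵈ one) base step t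
      where
        base : zeros m (n₀ + S z) ≡ one
        base = begin
          zeros m (n₀ + S z)  ≡⟨ cong (zeros m) (m+1≡suc n₀) ⟩
          zeros m (S n₀)      ≡⟨ zeros-suc-at-zero f-n₀ ⟩
          S (zeros m n₀)      ≡⟨ cong S (zeros-upto n₀ (≤-refl n₀)) ⟩
          one                 ∎
        step : ∀ t → zeros m (n₀ + S t) ≡ one → zeros m (n₀ + S (S t)) ≡ one
        step t h = begin
          zeros m (n₀ + S (S t))                            ≡⟨ cong (zeros m) (+-suc n₀ (S t)) ⟩
          zeros m (S (n₀ + S t))                            ≡⟨ zeros-suc m (n₀ + S t) ⟩
          zeros m (n₀ + S t) + is-zero (ap2 f m (n₀ + S t)) ≡⟨ cong₂ _+_ h (is-zero-≢ (f-off n₀+1+t≢n₀)) ⟩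
          one + z                                           ≡⟨ +-identityʳ one ⟩
          one                                               ∎
          where
            n₀+1+t≢n₀ : n₀ + S t ≢ n₀
            n₀+1+t≢n₀ e = <⇒≢ (t , refl) (sym e)

    σ-n₀ : σ m n₀ ≡ z
    σ-n₀ = trans (cong ((n₀ + is-zero (zeros m n₀)) ·sg_) f-n₀) (·sg-zero _)

    σ-below : ∀ {n} → S n ≤ n₀ → σ m n ≡ S n
    σ-below {n} Sn≤n₀ = begin
      (n + is-zero (zeros m n)) ·sg ap2 f m n  ≡⟨ ·sg-≢ _ (f-off (1+m≤n⇒m≢n Sn≤n₀)) ⟩
      n + is-zero (zeros m n)                  ≡⟨ cong (λ v → n + is-zero v) (zeros-upto n (1+m≤n⇒m≤n Sn≤n₀)) ⟩
      n + is-zero z                           ≡⟨ cong (n +_) is-zero-zero ⟩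
      n + one                                 ≡⟨ m+1≡suc n ⟩
      S n                                     ∎

    σ-above : ∀ {n} → n₀ < n → σ m n ≡ n
    σ-above {n} n₀<n = begin
      (n + is-zero (zeros m n)) ·sg ap2 f m n  ≡⟨ ·sg-≢ _ (f-off λ e → <⇒≢ n₀<n (sym e)) ⟩
      n + is-zero (zeros m n)                  ≡⟨ cong (λ v → n + is-zero v) (zeros-past-n₀ n₀<n) ⟩
      n + is-zero one                         ≡⟨ cong (n +_) (is-zero-suc z) ⟩
      n + z                                   ≡⟨ +-identityʳ n ⟩
      n                                       ∎

    off-n₀ : ∀ {n} → n ≢ n₀ → S n ≤ n₀ ⊎ n₀ < n
    off-n₀ {n} n≢n₀ with ≤⊎> n n₀
    ... | inj₁ n≤n₀ = inj₁ (≤∧≢⇒1+m≤n n≤n₀ n≢n₀)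
    ... | inj₂ n₀<n = inj₂ n₀<n

    σ≡z⇒≡n₀ : ∀ {n} → σ m n ≡ z → n ≡ n₀
    σ≡z⇒≡n₀ {n} σn≡z with em {n ≡ n₀}
    ... | yes n≡n₀ = n≡n₀
    ... | no n≢n₀ with off-n₀ n≢n₀
    ...   | inj₁ Sn≤n₀ = ⊥-elim (S≢z (trans (sym (σ-below Sn≤n₀)) σn≡z))
    ...   | inj₂ n₀<n = ⊥-elim (<⇒≱ n₀<n (subst (_≤ n₀) (sym n≡z) (0∸n≡0 n₀)))
      where
        n≡z : n ≡ z
        n≡z = trans (sym (σ-above n₀<n)) σn≡z

    σ-injective : ∀ {n n'} → σ m n ≡ σ m n' → n ≡ n'
    σ-injective {n} {n'} e with em {n ≡ n₀} | em {n' ≡ n₀}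
    ... | yes n≡n₀ | _ = trans n≡n₀ (sym (σ≡z⇒≡n₀ (trans (sym e) (trans (cong (σ m) n≡n₀) σ-n₀))))
    ... | no _ | yes n'≡n₀ = trans (σ≡z⇒≡n₀ (trans e (trans (cong (σ m) n'≡n₀) σ-n₀))) (sym n'≡n₀)
    ... | no n≢n₀ | no n'≢n₀ with off-n₀ n≢n₀ | off-n₀ n'≢n₀
    ...   | inj₁ Sn≤n₀ | inj₁ Sn'≤n₀ = succ-inj _ _ (trans (sym (σ-below Sn≤n₀)) (trans e (σ-below Sn'≤n₀)))
    ...   | inj₂ n₀<n | inj₂ n₀<n' = trans (sym (σ-above n₀<n)) (trans e (σ-above n₀<n'))
    ...   | inj₁ Sn≤n₀ | inj₂ n₀<n' = ⊥-elim (<⇒≱ (subst (n₀ <_) n'≡Sn n₀<n') Sn≤n₀)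
      where
        n'≡Sn : n' ≡ S n
        n'≡Sn = trans (sym (σ-above n₀<n')) (trans (sym e) (σ-below Sn≤n₀))
    ...   | inj₂ n₀<n | inj₁ Sn'≤n₀ = ⊥-elim (<⇒≱ (subst (n₀ <_) n≡Sn' n₀<n) Sn'≤n₀)
      where
        n≡Sn' : n ≡ S n'
        n≡Sn' = trans (sym (σ-above n₀<n)) (trans e (σ-below Sn'≤n₀))

    σ-surjective : ∀ j → Σ N λ n → σ m n ≡ j
    σ-surjective j with zero-or-suc j
    ... | inj₁ j≡z = n₀ , trans σ-n₀ (sym j≡z)
    ... | inj₂ (i , Si≡j) with ≤⊎> (S i) n₀
    ...   | inj₁ Si≤n₀ = i , trans (σ-below Si≤n₀) Si≡j
    ...   | inj₂ n₀<Si = S i , trans (σ-above n₀<Si) Si≡j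

  shift : N → N
  shift x = pair (fst x) (σ (fst x) (snd x))

  shiftᵈ : Definable₁ shift
  shiftᵈ = pairᵈ (fstᵈ π₁) (σᵈ (fstᵈ π₁) (sndᵈ π₁))

  shift-inverse : ∀ {x m n} → shift x ≡ pair m n → fst x ≡ m × σ m (snd x) ≡ n
  shift-inverse {x} e = fst≡m , trans (cong (λ a → σ a (snd x)) (sym fst≡m)) (proj₂ (pair-injective e))
    where
      fst≡m = proj₁ (pair-injective e)

  module _ (unique-zero : ∀ m → ∃!ᴹ M λ n → ap2 f m n ≡ z) where
    shift-bijective : ∀ t → ∃!ᴹ M λ x → shift x ≡ t
    shift-bijective t = pair m n , shift-pair , unique
      where
        m : N
        m = fst t
        open Row m (unique-zero m)
        n : N
        n = proj₁ (σ-surjective (snd t))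
        σn≡j : σ m n ≡ snd t
        σn≡j = proj₂ (σ-surjective (snd t))
        shift-pair : shift (pair m n) ≡ t
        shift-pair = trans (cong₂ (λ a b → pair a (σ a b)) (fst-pair m n) (snd-pair m n))
                           (trans (cong (pair m) σn≡j) (pair-fst-snd t))
        unique : ∀ x → shift x ≡ t → x ≡ pair m n
        unique x shift-x≡t = trans (sym (pair-fst-snd x))
          (cong₂ pair (proj₁ inverse) (σ-injective (trans (proj₂ inverse) (sym σn≡j))))
          where inverse = shift-inverse (trans shift-x≡t (sym (pair-fst-snd t)))

    shift≡pair-z : ∀ {x m} → shift x ≡ pair m z → ap2 f m (snd x) ≡ z
    shift≡pair-z {x} {m} e = trans (cong (ap2 f m) (σ≡z⇒≡n₀ (proj₂ (shift-inverse e)))) f-n₀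
      where open Row m (unique-zero m)

module Implications (em : ExcludedMiddle 0ℓ) {M : Structure} (PA : PRAfcn M) where
  open Structure M
  open PRAfcn PA
  open Pairing em PA

  private
    module Perm = Permutation em PA
    module Min = Minimisation em PA

  MIN3⇒MIN2 : MIN3 M → MIN2 M
  MIN3⇒MIN2 min3 f has-zero =
    let (F , F≡)    = app₂ f π₁ π₃
        (G , least) = min3 F λ m n → proj₁ (has-zero m) , trans (F≡ m n _) (proj₂ (has-zero m))
        (g , g≡)    = asUnary (app₂ G π₁ (constᵈ z))
    in g , λ m →
      trans (cong (ap2 f m) (g≡ m)) (trans (sym (F≡ m z _)) (proj₁ (least m z))) ,
      λ r r<gm fr≡z → proj₂ (least m z) r (subst (_<ᴹ_ M r) (g≡ m) r<gm) (trans (F≡ m z r) fr≡z)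

  MIN2⇒MIN1 : MIN2 M → MIN1 M
  MIN2⇒MIN1 min2 f unique-zero =
    let (g , least) = min2 f λ m → proj₁ (unique-zero m) , proj₁ (proj₂ (unique-zero m))
    in g , λ m → proj₁ (least m)

  MIN1⇒PERM : MIN1 M → PERM M
  MIN1⇒PERM min1 f bijective =
    let (F , F≡)   = asBinary (distᵈ (app₁ f π₂) π₁)
        (g , zero) = min1 F λ n → ∃!ᴹ-cong (F≡ n) (∃!ᴹ-dist (bijective n))
    in g , λ n → dist≡0⇒≡ (trans (sym (F≡ n _)) (zero n))

  PERM⇒MIN1 : PERM M → MIN1 M
  PERM⇒MIN1 perm f unique-zero =
    let open Perm f
        (P , P≡)         = asUnary shiftᵈ
        (G , G-inverse)  = perm P λ t → ∃!ᴹ-cong P≡ (shift-bijective unique-zero t)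
        (g , g≡)         = asUnary (sndᵈ (app₁ G (pairᵈ π₁ (constᵈ z))))
    in g , λ m → trans (cong (ap2 f m) (g≡ m))
                       (shift≡pair-z unique-zero (trans (sym (P≡ _)) (G-inverse (pair m z))))

  MIN1⇒MIN3 : MIN1 M → MIN3 M
  MIN1⇒MIN3 min1 f has-zero =
    let open Min f
        (F , F≡)     = asBinary (φᵈ π₁ π₂ +ᵈ zerosᵈ π₁ π₂)
        (G , G-zero) = min1 F λ p → ∃!ᴹ-cong (F≡ p) (least-zero-∃! (proj₂ (has-zero (fst p) (snd p))))
        (g , g≡)     = asBinary (app₁ G (pairᵈ π₁ π₂))
        least : ∀ p → LeastZero p (ap1 G p)
        least p = +-eq-zero (trans (sym (F≡ p _)) (G-zero p))
    in g , λ m n →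
      trans (cong (ap3 f m n) (g≡ m n)) (trans (sym (φ-pair m n _)) (proj₁ (least (pair m n)))) ,
      λ r r<gmn fr≡z → zeros-after (trans (φ-pair m n r) fr≡z) (subst (r <_) (g≡ m n) (<ᴹ⇒< r<gmn))
                                   (proj₂ (least (pair m n)))

theorem2 : ExcludedMiddle 0ℓ → (M : Structure) → PRAfcn M →
    (MIN3 M ⇔ MIN2 M) × (MIN3 M ⇔ MIN1 M) × (MIN3 M ⇔ PERM M) ×
    (MIN2 M ⇔ MIN1 M) × (MIN2 M ⇔ PERM M) × (MIN1 M ⇔ PERM M)
theorem2 em M PA =
  mk⇔ MIN3⇒MIN2 (MIN1⇒MIN3 ∘ MIN2⇒MIN1) ,
  mk⇔ (MIN2⇒MIN1 ∘ MIN3⇒MIN2) MIN1⇒MIN3 ,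
  mk⇔ (MIN1⇒PERM ∘ MIN2⇒MIN1 ∘ MIN3⇒MIN2) (MIN1⇒MIN3 ∘ PERM⇒MIN1) ,
  mk⇔ MIN2⇒MIN1 (MIN3⇒MIN2 ∘ MIN1⇒MIN3) ,
  mk⇔ (MIN1⇒PERM ∘ MIN2⇒MIN1) (MIN3⇒MIN2 ∘ MIN1⇒MIN3 ∘ PERM⇒MIN1) ,
  mk⇔ MIN1⇒PERM PERM⇒MIN1
  where open Implications em PA
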